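{- Let $G=(V,E,w)$ be a graph on $n$ vertices with positive edge weights, fix an ordering $\pi$ of $E$ by non-increasing weight (ties broken arbitrarily), and let $e_1,\ldots,e_{n-1}$ be the spanning tree edges selected by Kruskal's algorithm in order $\pi$, listed in order of insertion. Define the set $J\subseteq[n-1]$ of "stored" indices by: $j\in J$ if and only if there is no $k<j$ with $k\in J$ and $w(e_k)/w(e_j)<2$. For $k\in[n-1]$ let $G_k$ be the graph obtained from $G$ by (i) removing all edges $e$ with $w(e)<w(e_k)/n^3$ and (ii) changing every edge $e$ with $w(e)\ge n^2\cdot w(e_k)$ to have infinite weight. Given a query $S\subset V$ ($\emptyset\ne S\ne V$), let $j$ be the smallest index such that $e_j$ crosses the cut $(S,\bar S)$, and let $k$ be the largest element of $J$ with $k\le j$. Then $$1-\tfrac1n\le\frac{w_{G_k}(S,\bar S)}{w_G(S,\bar S)}\le1.$$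
   Context: Kruskal's algorithm here: start with the empty graph on $V$ and go over the edges in order $\pi$, adding an edge if its endpoints are currently in different connected components. An edge crosses $(S,\bar S)$ if it has exactly one endpoint in $S$. $w_H(S,\bar S)$ denotes the total weight of edges of the graph $H$ crossing $(S,\bar S)$. -}

module Defs where

open import Data.Nat using (ℕ; zero; suc; _^_)
open import Data.Integer using (+_)
open import Data.Rational using (ℚ; _/_; _+_; _*_; _<_; _≤_; _≥_; 0ℚ)
open import Data.Rational.Properties using (_<?_; _≤?_)
open import Data.Fin using (Fin; _≟_)
open import Data.Fin.Subset using (Subset; _∈_; _∉_)
open import Data.Bool using (Bool; true; false; if_then_else_; _≟_)
open import Data.List using (List; []; _∷_)
open import Data.List.Relation.Unary.Any using (Any)
import Data.List.Membership.Propositional as Mem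
open import Data.Maybe using (Maybe; just; nothing)
open import Data.Product using (_×_; _,_)
open import Data.Sum using (_⊎_)
open import Relation.Binary.PropositionalEquality using (_≡_; _≢_)
open import Relation.Nullary using (¬_; yes; no)
open import Data.Vec using (lookup)

ℕ→ℚ : ℕ → ℚ
ℕ→ℚ m = + m / 1

record Edge (n : ℕ) : Set where
  constructor edge
  field
    src    : Fin n
    tgt    : Fin n
    weight : ℚ
open Edge public

SamePair : ∀ {n} → Edge n → Edge n → Set
SamePair e f = (src e ≡ src f × tgt e ≡ tgt f) ⊎ (src e ≡ tgt f × tgt e ≡ src f)

data Reach {n : ℕ} (E : List (Edge n)) : Fin n → Fin n → Set where
  here : ∀ {x} → Reach E x x
  step : ∀ {x y z} (e : Edge n) → e Mem.∈ E →
         SamePair e (edge x y (weight e)) → Reach E y z → Reach E x z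

Connected : (n : ℕ) → List (Edge n) → Set
Connected n E = ∀ (x y : Fin n) → Reach E x y

-- Connected components of the current forest are
-- tracked by a labelling c : Fin n → Fin n (x, y in the same component
-- iff c x ≡ c y).

relabel : ∀ {n} → (Fin n → Fin n) → Fin n → Fin n → Fin n → Fin n
relabel c a b x with c x Data.Fin.≟ a
... | yes _ = b
... | no  _ = c x

kruskalGo : ∀ {n} → (Fin n → Fin n) → List (Edge n) → List (Edge n)
kruskalGo c [] = []
kruskalGo c (e ∷ es) with c (src e) Data.Fin.≟ c (tgt e)
... | yes _ = kruskalGo c es
... | no  _ = e ∷ kruskalGo (relabel c (c (tgt e)) (c (src e))) es

-- the tree edges e_1, e_2, ... in order of insertion (0-based list)
kruskal : ∀ {n} → List (Edge n) → List (Edge n)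
kruskal π = kruskalGo (λ x → x) π

nth : ∀ {A : Set} → List A → ℕ → Maybe A
nth []       _       = nothing
nth (x ∷ xs) zero    = just x
nth (x ∷ xs) (suc k) = nth xs k

-- stored indices J: j ∈ J iff there is no earlier stored k with
-- w(e_k)/w(e_j) < 2, i.e. w(e_k) < 2·w(e_j) (weights positive).

anyClose : List ℚ → ℚ → Bool
anyClose []       w = false
anyClose (u ∷ us) w with u <? (ℕ→ℚ 2 * w)
... | yes _ = true
... | no  _ = anyClose us w

storedGo : ∀ {n} → List ℚ → List (Edge n) → List Bool
storedGo {n} = go
  where
  go : List ℚ → List (Edge n) → List Bool
  go acc []       = []
  go acc (e ∷ es) with anyClose acc (weight e)
  ... | true  = false ∷ go acc es
  ... | false = true ∷ go (weight e ∷ acc) es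

InJ : ∀ {n} → List (Edge n) → ℕ → Set
InJ T k = nth (storedGo [] T) k ≡ just true

Crosses : ∀ {n} → Subset n → Edge n → Set
Crosses S e = lookup S (src e) ≢ lookup S (tgt e)

crosses? : ∀ {n} → Subset n → Edge n → Bool
crosses? S e with lookup S (src e) Data.Bool.≟ lookup S (tgt e)
... | yes _ = false
... | no  _ = true

cutWeight : ∀ {n} → List (Edge n) → Subset n → ℚ
cutWeight []       S = 0ℚ
cutWeight (e ∷ es) S = (if crosses? S e then weight e else 0ℚ) + cutWeight es S

data ℚ∞ : Set where
  fin : ℚ → ℚ∞
  ∞   : ℚ∞

_+∞_ : ℚ∞ → ℚ∞ → ℚ∞
fin a +∞ fin b = fin (a + b)
_     +∞ _     = ∞

-- weight of an edge e in G_k, where wk = w(e_k):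
--   removed (contributes 0) if w(e) < wk / n³   (i.e. n³·w(e) < wk)
--   infinite if w(e) ≥ n²·wk, unchanged otherwise
weightGk : (n : ℕ) → ℚ → Edge n → ℚ∞
weightGk n wk e with (ℕ→ℚ (n ^ 3) * weight e) <? wk | (ℕ→ℚ (n ^ 2) * wk) ≤? weight e
... | yes _ | _     = fin 0ℚ
... | no  _ | yes _ = ∞
... | no  _ | no  _ = fin (weight e)

cutWeightGk : (n : ℕ) → ℚ → List (Edge n) → Subset n → ℚ∞
cutWeightGk n wk []       S = fin 0ℚ
cutWeightGk n wk (e ∷ es) S =
  (if crosses? S e then weightGk n wk e else fin 0ℚ) +∞ cutWeightGk n wk es S

-- Until Kruskal adds e_j, each component it has built lies on one side of (S, S̄), so it rejects
-- no cut edge and every cut edge of π comes after e_j in π.  Hence all cut edges weigh at most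
-- w(e_j) ≤ w(e_k) ≤ 2 w(e_j), the last because some stored index up to j has weight below
-- 2 w(e_j).  So no cut edge becomes infinite in G_k and each removed one weighs less than
-- w(e_k)/n³.  The cut edges join distinct pairs across the cut, so there are at most n²/2 of
-- them and the removed weight is at most (n²/2)(2 w(e_j))/n³ = w(e_j)/n ≤ w_G(S, S̄)/n.
module Submission where

open import Defs
open import Data.Nat using (ℕ; _∸_) renaming (_<_ to _<ℕ_; _≤_ to _≤ℕ_)
open import Data.Rational using (ℚ; _*_; _<_; _≤_; 0ℚ)
open import Data.Fin using (Fin)
open import Data.Fin.Subset using (Subset; _∈_; _∉_)
open import Data.List using (List)
open import Data.List.Relation.Unary.All using (All)
open import Data.List.Relation.Unary.AllPairs using (AllPairs)
open import Data.Maybe using (just)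
open import Data.Product using (Σ; ∃; _×_)
open import Relation.Binary.PropositionalEquality using (_≡_; _≢_)
open import Relation.Nullary using (¬_)

open import Data.Bool as Bool using (Bool; true; false)
open import Data.Empty using (⊥-elim)
open import Data.Fin as Fin using (combine; remQuot)
open import Data.Fin.Properties using (pigeonhole; remQuot-combine)
open import Data.Integer as ℤ using (+_)
import Data.Integer.Properties as ℤ
open import Data.List as List using ([]; _∷_; length; map; filter; _++_)
open import Data.List.Properties using (length-map; length-++)
open import Data.List.Membership.Propositional using () renaming (_∈_ to _∈ₗ_)
open import Data.List.Membership.Propositional.Properties using (∈-map⁻; ∈-lookup)
open import Data.List.Relation.Binary.Disjoint.Propositional using (Disjoint)
open import Data.List.Relation.Binary.Sublist.Propositional using (_⊆_; []; _∷_; _∷ʳ_)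
open import Data.List.Relation.Binary.Sublist.Propositional.Properties using (All-resp-⊆; Any-resp-⊆)
open import Data.List.Relation.Unary.All as All using ([]; _∷_)
import Data.List.Relation.Unary.All.Properties as All
open import Data.List.Relation.Unary.All.Properties using (all-filter)
open import Data.List.Relation.Unary.AllPairs as AllPairs using ([]; _∷_)
import Data.List.Relation.Unary.AllPairs.Properties as AllPairs
open import Data.List.Relation.Unary.Any using (Any; here; there)
open import Data.List.Relation.Unary.Unique.Propositional using (Unique)
import Data.List.Relation.Unary.Unique.Propositional.Properties as Unique
open import Data.Maybe.Properties using (just-injective)
open import Data.Nat as ℕ using (zero; suc; z≤n; s≤s; z<s; s<s; _^_)
open import Data.Nat.Coprimality using (1-coprimeTo) renaming (sym to coprime-sym)
import Data.Nat.Properties as ℕ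
open import Data.Product using (_,_; proj₁; proj₂; swap; uncurry; ∃₂)
open import Data.Rational using (mkℚ; _+_; -_; 1ℚ; toℚᵘ; *≤*; *<*; nonNegative; positive)
open import Data.Rational.Properties
open import Data.Rational.Solver using (module +-*-Solver)
open +-*-Solver using (solve; _:+_; _:*_; :-_; _:=_; con)
import Data.Rational.Unnormalised as ℚᵘ
import Data.Rational.Unnormalised.Properties as ℚᵘ
open import Data.Sum as Sum using (_⊎_; inj₁; inj₂)
open import Data.Vec using (lookup)
open import Function using (_∘_; id)
open import Relation.Binary.PropositionalEquality using (refl; sym; trans; cong; cong₂; subst)
open import Relation.Nullary using (yes; no; ¬?)
open import Relation.Unary using (Decidable)

ℕ→ℚ≡mkℚ : ∀ m → ℕ→ℚ m ≡ mkℚ (+ m) 0 (coprime-sym (1-coprimeTo m))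
ℕ→ℚ≡mkℚ m = normalize-coprime (coprime-sym (1-coprimeTo m))

toℚᵘ-ℕ→ℚ : ∀ m → toℚᵘ (ℕ→ℚ m) ≡ ℚᵘ.mkℚᵘ (+ m) 0
toℚᵘ-ℕ→ℚ m rewrite ℕ→ℚ≡mkℚ m = refl

ℕ→ℚ-homo-+ : ∀ a b → ℕ→ℚ (a ℕ.+ b) ≡ ℕ→ℚ a + ℕ→ℚ b
ℕ→ℚ-homo-+ a b = toℚᵘ-injective (begin
  toℚᵘ (ℕ→ℚ (a ℕ.+ b))                         ≡⟨ toℚᵘ-ℕ→ℚ (a ℕ.+ b) ⟩
  ℚᵘ.mkℚᵘ (+ (a ℕ.+ b)) 0
    ≈⟨ ℚᵘ.*≡* (cong (ℤ._* + 1) (sym (cong₂ ℤ._+_ (ℤ.*-identityʳ (+ a)) (ℤ.*-identityʳ (+ b))))) ⟩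
  ℚᵘ.mkℚᵘ (+ a) 0 ℚᵘ.+ ℚᵘ.mkℚᵘ (+ b) 0          ≡⟨ sym (cong₂ ℚᵘ._+_ (toℚᵘ-ℕ→ℚ a) (toℚᵘ-ℕ→ℚ b)) ⟩
  toℚᵘ (ℕ→ℚ a) ℚᵘ.+ toℚᵘ (ℕ→ℚ b)               ≈⟨ ℚᵘ.≃-sym (toℚᵘ-homo-+ (ℕ→ℚ a) (ℕ→ℚ b)) ⟩
  toℚᵘ (ℕ→ℚ a + ℕ→ℚ b)                          ∎)
  where open ℚᵘ.≃-Reasoning

ℕ→ℚ-homo-* : ∀ a b → ℕ→ℚ (a ℕ.* b) ≡ ℕ→ℚ a * ℕ→ℚ b
ℕ→ℚ-homo-* a b = toℚᵘ-injective (begin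
  toℚᵘ (ℕ→ℚ (a ℕ.* b))                         ≡⟨ toℚᵘ-ℕ→ℚ (a ℕ.* b) ⟩
  ℚᵘ.mkℚᵘ (+ (a ℕ.* b)) 0                       ≡⟨ cong (λ i → ℚᵘ.mkℚᵘ i 0) (ℤ.pos-* a b) ⟩
  ℚᵘ.mkℚᵘ (+ a) 0 ℚᵘ.* ℚᵘ.mkℚᵘ (+ b) 0          ≡⟨ sym (cong₂ ℚᵘ._*_ (toℚᵘ-ℕ→ℚ a) (toℚᵘ-ℕ→ℚ b)) ⟩
  toℚᵘ (ℕ→ℚ a) ℚᵘ.* toℚᵘ (ℕ→ℚ b)               ≈⟨ ℚᵘ.≃-sym (toℚᵘ-homo-* (ℕ→ℚ a) (ℕ→ℚ b)) ⟩
  toℚᵘ (ℕ→ℚ a * ℕ→ℚ b)                          ∎)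
  where open ℚᵘ.≃-Reasoning

ℕ→ℚ-mono-≤ : ∀ {a b} → a ℕ.≤ b → ℕ→ℚ a ≤ ℕ→ℚ b
ℕ→ℚ-mono-≤ {a} {b} a≤b rewrite ℕ→ℚ≡mkℚ a | ℕ→ℚ≡mkℚ b =
  *≤* (ℤ.*-monoʳ-≤-nonNeg (+ 1) (ℤ.+≤+ a≤b))

ℕ→ℚ-mono-< : ∀ {a b} → a ℕ.< b → ℕ→ℚ a < ℕ→ℚ b
ℕ→ℚ-mono-< {a} {b} a<b rewrite ℕ→ℚ≡mkℚ a | ℕ→ℚ≡mkℚ b =
  *<* (ℤ.*-monoʳ-<-pos (+ 1) (ℤ.+<+ a<b))

nth-∈ : ∀ {A : Set} (xs : List A) i {x} → nth xs i ≡ just x → x ∈ₗ xs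
nth-∈ (y ∷ xs) zero    eq = here (sym (just-injective eq))
nth-∈ (y ∷ xs) (suc i) eq = there (nth-∈ xs i eq)

AllPairs-nth : ∀ {A : Set} {R : A → A → Set} {xs : List A} → AllPairs R xs →
  ∀ {i j a b} → i <ℕ j → nth xs i ≡ just a → nth xs j ≡ just b → R a b
AllPairs-nth {xs = x ∷ xs} (x~xs ∷ _) {zero} {suc j} _ refl xs[j] =
  All.lookup x~xs (nth-∈ xs j xs[j])
AllPairs-nth (_ ∷ ~xs) {suc i} {suc j} (s<s i<j) = AllPairs-nth ~xs i<j

AllPairs-lookup : ∀ {A : Set} {R : A → A → Set} {xs : List A} → AllPairs R xs →
  ∀ {i j} → i Fin.< j → R (List.lookup xs i) (List.lookup xs j)
AllPairs-lookup {xs = x ∷ xs} (x~xs ∷ _) {Fin.zero} {Fin.suc j} _ =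
  All.lookup x~xs (∈-lookup {xs = xs} j)
AllPairs-lookup (_ ∷ ~xs) {Fin.suc i} {Fin.suc j} (s<s i<j) = AllPairs-lookup ~xs i<j

AllPairs-resp-⊇ : ∀ {A : Set} {R : A → A → Set} {xs ys : List A} →
  xs ⊆ ys → AllPairs R ys → AllPairs R xs
AllPairs-resp-⊇ []             []           = []
AllPairs-resp-⊇ (y ∷ʳ xs⊆ys)   (_ ∷ ~ys)    = AllPairs-resp-⊇ xs⊆ys ~ys
AllPairs-resp-⊇ (refl ∷ xs⊆ys) (y~ys ∷ ~ys) = All-resp-⊆ xs⊆ys y~ys ∷ AllPairs-resp-⊇ xs⊆ys ~ys

kruskalGo-⊆ : ∀ {n} (c : Fin n → Fin n) (es : List (Edge n)) → kruskalGo c es ⊆ es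
kruskalGo-⊆ c []       = []
kruskalGo-⊆ c (e ∷ es) with c (src e) Fin.≟ c (tgt e)
... | yes _ = e ∷ʳ kruskalGo-⊆ c es
... | no  _ = refl ∷ kruskalGo-⊆ _ es

NonIncreasing : ∀ {n} → List (Edge n) → Set
NonIncreasing = AllPairs (λ e f → weight f ≤ weight e)

NonIncreasing-nth : ∀ {n} {es : List (Edge n)} → NonIncreasing es →
  ∀ {i j a b} → i ≤ℕ j → nth es i ≡ just a → nth es j ≡ just b → weight b ≤ weight a
NonIncreasing-nth sorted i≤j es[i] es[j] with ℕ.m≤n⇒m<n∨m≡n i≤j
... | inj₁ i<j  = AllPairs-nth sorted i<j es[i] es[j]
... | inj₂ refl with refl ← just-injective (trans (sym es[i]) es[j]) = ≤-refl

head-heaviest : ∀ {n} {e₀ e : Edge n} {es} → All (λ f → weight f ≤ weight e₀) es →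
  e ∈ₗ e₀ ∷ es → weight e ≤ weight e₀
head-heaviest _      (here refl) = ≤-refl
head-heaviest e₀≥es  (there e∈)  = All.lookup e₀≥es e∈

anyClose-sound : ∀ us w → anyClose us w ≡ true → Any (_< ℕ→ℚ 2 * w) us
anyClose-sound (u ∷ us) w close with u <? ℕ→ℚ 2 * w
... | yes u<2w = here u<2w
... | no  _    = there (anyClose-sound us w close)

record StoredBefore {n} (stored : List Bool) (T : List (Edge n)) (j : ℕ) (w : ℚ) : Set where
  constructor stored-before
  field
    index        : ℕ
    stored-edge  : Edge n
    index<j      : index <ℕ j
    index-stored : nth stored index ≡ just true
    T[index]     : nth T index ≡ just stored-edge
    lighter      : weight stored-edge < ℕ→ℚ 2 * w

StoredBefore-suc : ∀ {n} {stored T j w b} {e₀ : Edge n} →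
  StoredBefore stored T j w → StoredBefore (b ∷ stored) (e₀ ∷ T) (suc j) w
StoredBefore-suc (stored-before k e k<j stored T[k] lighter) =
  stored-before (suc k) e (s<s k<j) stored T[k] lighter

storedGo-covers : ∀ {n} acc (T : List (Edge n)) j {e} → nth T j ≡ just e →
  nth (storedGo acc T) j ≡ just true
  ⊎ Any (_< ℕ→ℚ 2 * weight e) acc
  ⊎ StoredBefore (storedGo acc T) T j (weight e)
storedGo-covers acc (e₀ ∷ es) j T[j] with anyClose acc (weight e₀) in close
storedGo-covers acc (e₀ ∷ es) zero refl | true  = inj₂ (inj₁ (anyClose-sound acc _ close))
storedGo-covers acc (e₀ ∷ es) zero refl | false = inj₁ refl
storedGo-covers acc (e₀ ∷ es) (suc j) T[j] | true =
  Sum.map₂ (Sum.map₂ StoredBefore-suc) (storedGo-covers acc es j T[j])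
storedGo-covers acc (e₀ ∷ es) (suc j) T[j] | false with storedGo-covers (weight e₀ ∷ acc) es j T[j]
... | inj₁ stored                 = inj₁ stored
... | inj₂ (inj₁ (here e₀<2w))    = inj₂ (inj₂ (stored-before 0 e₀ z<s refl refl e₀<2w))
... | inj₂ (inj₁ (there close′))  = inj₂ (inj₁ close′)
... | inj₂ (inj₂ before)          = inj₂ (inj₂ (StoredBefore-suc before))

nonNeg⇒p≤2*p : ∀ {p} → 0ℚ ≤ p → p ≤ ℕ→ℚ 2 * p
nonNeg⇒p≤2*p {p} p≥0 = begin
  p          ≡⟨ sym (+-identityʳ p) ⟩
  p + 0ℚ     ≤⟨ +-monoʳ-≤ p p≥0 ⟩
  p + p      ≡⟨ solve 1 (λ p → p :+ p := con (ℕ→ℚ 2) :* p) refl p ⟩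
  ℕ→ℚ 2 * p  ∎
  where open ≤-Reasoning

covered-by-stored : ∀ {n} (T : List (Edge n)) j {e} → nth T j ≡ just e → 0ℚ ≤ weight e →
  ∃₂ λ k e′ → k ≤ℕ j × InJ T k × nth T k ≡ just e′ × weight e′ ≤ ℕ→ℚ 2 * weight e
covered-by-stored T j {e} T[j] w≥0 with storedGo-covers [] T j T[j]
... | inj₁ stored = j , e , ℕ.≤-refl , stored , T[j] , nonNeg⇒p≤2*p w≥0
... | inj₂ (inj₂ (stored-before k e′ k<j stored T[k] lighter)) =
  k , e′ , ℕ.<⇒≤ k<j , stored , T[k] , <⇒≤ lighter

length-unique-≤ : ∀ {m} {xs : List (Fin m)} → Unique xs → length xs ≤ℕ m
length-unique-≤ {m} {xs} unique with length xs ℕ.≤? m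
... | yes fits = fits
... | no  overfull with pigeonhole (ℕ.≰⇒> overfull) (List.lookup xs)
...   | i , j , i<j , collide = ⊥-elim (AllPairs-lookup unique i<j collide)

length-unique-pairs-≤ : ∀ {m} {xs : List (Fin m × Fin m)} → Unique xs → length xs ≤ℕ m ℕ.* m
length-unique-pairs-≤ {m} {xs} unique =
  subst (_≤ℕ m ℕ.* m) (length-map (uncurry combine) xs)
    (length-unique-≤ (Unique.map⁺ combine-injective unique))
  where
  combine-injective : ∀ {p q : Fin m × Fin m} → uncurry combine p ≡ uncurry combine q → p ≡ q
  combine-injective {a , b} {c , d} eq =
    trans (sym (remQuot-combine a b)) (trans (cong (remQuot m) eq) (remQuot-combine c d))

-- A list of distinct ordered pairs that all go from P to its complement can be doubled by
-- adding the reversed pairs.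
length-separated-≤ : ∀ {m} (P : Fin m → Set) {xs : List (Fin m × Fin m)} → Unique xs →
  All (λ p → P (proj₁ p) × ¬ P (proj₂ p)) xs → 2 ℕ.* length xs ≤ℕ m ℕ.* m
length-separated-≤ P {xs} unique separated =
  subst (_≤ℕ _) doubled
    (length-unique-pairs-≤ (Unique.++⁺ unique (Unique.map⁺ (cong swap) unique) disjoint))
  where
  disjoint : Disjoint xs (map swap xs)
  disjoint (p∈xs , p∈swapped) with ∈-map⁻ swap p∈swapped
  ... | q , q∈xs , refl = proj₂ (All.lookup separated q∈xs) (proj₁ (All.lookup separated p∈xs))
  doubled : length (xs ++ map swap xs) ≡ 2 ℕ.* length xs
  doubled = trans (length-++ xs)
    (cong (length xs ℕ.+_) (trans (length-map swap xs) (sym (ℕ.+-identityʳ _))))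

record Shortfall (N wk : ℚ) (m : ℕ) (g : ℚ∞) (w : ℚ) : Set where
  constructor shortfall
  field
    kept lost   : ℚ
    g≡kept      : g ≡ fin kept
    w≡kept+lost : w ≡ kept + lost
    lost-nonneg : 0ℚ ≤ lost
    lost-bound  : N * lost ≤ ℕ→ℚ m * wk

Shortfall-0 : ∀ {N wk} → Shortfall N wk 0 (fin 0ℚ) 0ℚ
Shortfall-0 {N} {wk} =
  shortfall 0ℚ 0ℚ refl refl ≤-refl (≤-reflexive (trans (*-zeroʳ N) (sym (*-zeroˡ wk))))

Shortfall-+ : ∀ {N wk m m′ g g′ w w′} → Shortfall N wk m g w → Shortfall N wk m′ g′ w′ →
  Shortfall N wk (m ℕ.+ m′) (g +∞ g′) (w + w′)
Shortfall-+ {N} {wk} {m} {m′} (shortfall v r refl refl r≥0 Nr≤) (shortfall v′ r′ refl refl r′≥0 Nr′≤) =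
  shortfall (v + v′) (r + r′) refl
    (solve 4 (λ v r v′ r′ → (v :+ r) :+ (v′ :+ r′) := (v :+ v′) :+ (r :+ r′)) refl v r v′ r′)
    (+-mono-≤ r≥0 r′≥0)
    (begin
      N * (r + r′)                 ≡⟨ *-distribˡ-+ N r r′ ⟩
      N * r + N * r′               ≤⟨ +-mono-≤ Nr≤ Nr′≤ ⟩
      ℕ→ℚ m * wk + ℕ→ℚ m′ * wk     ≡⟨ sym (*-distribʳ-+ wk (ℕ→ℚ m) (ℕ→ℚ m′)) ⟩
      (ℕ→ℚ m + ℕ→ℚ m′) * wk        ≡⟨ cong (_* wk) (sym (ℕ→ℚ-homo-+ m m′)) ⟩
      ℕ→ℚ (m ℕ.+ m′) * wk          ∎)
  where open ≤-Reasoning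

crossing-edge-shortfall : ∀ {n wk} {e : Edge n} → 1 <ℕ n → 0ℚ < weight e → weight e ≤ wk →
  Shortfall (ℕ→ℚ (n ^ 3)) wk 1 (weightGk n wk e) (weight e)
crossing-edge-shortfall {n} {wk} {e} 1<n w>0 w≤wk
  with ℕ→ℚ (n ^ 3) * weight e <? wk | ℕ→ℚ (n ^ 2) * wk ≤? weight e
... | yes light | _ =
  shortfall 0ℚ (weight e) refl (sym (+-identityˡ _)) (<⇒≤ w>0)
    (≤-trans (<⇒≤ light) (≤-reflexive (sym (*-identityˡ wk))))
... | no _ | yes heavy = ⊥-elim (<-irrefl refl (<-≤-trans wk<n²wk (≤-trans heavy w≤wk)))
  where
  wk>0 : 0ℚ < wk
  wk>0 = <-≤-trans w>0 w≤wk
  wk<n²wk : wk < ℕ→ℚ (n ^ 2) * wk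
  wk<n²wk = subst (_< ℕ→ℚ (n ^ 2) * wk) (*-identityˡ wk)
    (*-monoˡ-<-pos wk {{positive wk>0}} (ℕ→ℚ-mono-< (ℕ.≤-trans (s≤s (s≤s z≤n)) (ℕ.^-monoˡ-≤ 2 1<n))))
... | no _ | no _ =
  shortfall (weight e) 0ℚ refl (sym (+-identityʳ _)) ≤-refl
    (≤-trans (≤-reflexive (*-zeroʳ (ℕ→ℚ (n ^ 3)))) (≤-trans (<⇒≤ (<-≤-trans w>0 w≤wk)) (≤-reflexive (sym (*-identityˡ wk)))))

module _ {n} (S : Subset n) where

  RespectsCut : (Fin n → Fin n) → Set
  RespectsCut c = ∀ x y → c x ≡ c y → lookup S x ≡ lookup S y

  relabel-respects : ∀ c e → RespectsCut c → lookup S (src e) ≡ lookup S (tgt e) →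
    RespectsCut (relabel c (c (tgt e)) (c (src e)))
  relabel-respects c e resp same x y with c x Fin.≟ c (tgt e) | c y Fin.≟ c (tgt e)
  ... | yes x~t | yes y~t = λ _ → resp x y (trans x~t (sym y~t))
  ... | yes x~t | no  _   = λ s~y → trans (resp x (tgt e) x~t) (trans (sym same) (resp (src e) y s~y))
  ... | no  _   | yes y~t = λ x~s → trans (resp x (src e) x~s) (trans same (sym (resp y (tgt e) y~t)))
  ... | no  _   | no  _   = resp x y

  crossing-∈-tail : ∀ {e₀ e : Edge n} {es} → lookup S (src e₀) ≡ lookup S (tgt e₀) →
    Crosses S e → e ∈ₗ e₀ ∷ es → e ∈ₗ es
  crossing-∈-tail same e-cr (here refl) = ⊥-elim (e-cr same)
  crossing-∈-tail same e-cr (there e∈) = e∈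

  first-crossing-heaviest : ∀ c es → RespectsCut c → NonIncreasing es →
    ∀ j {ej} → nth (kruskalGo c es) j ≡ just ej → Crosses S ej →
    (∀ i e → i <ℕ j → nth (kruskalGo c es) i ≡ just e → ¬ Crosses S e) →
    ∀ {e} → e ∈ₗ es → Crosses S e → weight e ≤ weight ej
  first-crossing-heaviest c (e₀ ∷ es) resp (e₀≥es ∷ sorted) j ej≡ ej-cr earlier e∈ e-cr
    with lookup S (src e₀) Bool.≟ lookup S (tgt e₀) | c (src e₀) Fin.≟ c (tgt e₀)
  ... | no e₀-cr | yes joined = ⊥-elim (e₀-cr (resp _ _ joined))
  ... | yes same | yes _ =
    first-crossing-heaviest c es resp sorted j ej≡ ej-cr earlier (crossing-∈-tail same e-cr e∈) e-cr
  first-crossing-heaviest c (e₀ ∷ es) resp (e₀≥es ∷ sorted) zero ej≡ ej-cr earlier e∈ e-cr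
    | no e₀-cr | no _ with refl ← just-injective ej≡ = head-heaviest e₀≥es e∈
  first-crossing-heaviest c (e₀ ∷ es) resp (e₀≥es ∷ sorted) (suc j) ej≡ ej-cr earlier e∈ e-cr
    | no e₀-cr | no _ = ⊥-elim (earlier 0 e₀ z<s refl e₀-cr)
  first-crossing-heaviest c (e₀ ∷ es) resp (e₀≥es ∷ sorted) zero ej≡ ej-cr earlier e∈ e-cr
    | yes same | no _ with refl ← just-injective ej≡ = ⊥-elim (ej-cr same)
  first-crossing-heaviest c (e₀ ∷ es) resp (e₀≥es ∷ sorted) (suc j) ej≡ ej-cr earlier e∈ e-cr
    | yes same | no _ =
    first-crossing-heaviest _ es (relabel-respects c e₀ resp same) sorted j ej≡ ej-cr
      (λ i e i<j → earlier (suc i) e (s<s i<j)) (crossing-∈-tail same e-cr e∈) e-cr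

  Crosses? : Decidable (Crosses S)
  Crosses? e = ¬? (lookup S (src e) Bool.≟ lookup S (tgt e))

  orient : Edge n → Fin n × Fin n
  orient e = Bool.if lookup S (src e) then (src e , tgt e) else (tgt e , src e)

  orient-injective : ∀ {e f} → orient e ≡ orient f → SamePair e f
  orient-injective {e} {f} eq with lookup S (src e) | lookup S (src f)
  ... | true  | true  = inj₁ (cong proj₁ eq , cong proj₂ eq)
  ... | true  | false = inj₂ (cong proj₁ eq , cong proj₂ eq)
  ... | false | true  = inj₂ (cong proj₂ eq , cong proj₁ eq)
  ... | false | false = inj₁ (cong proj₂ eq , cong proj₁ eq)

  orient-crossing : ∀ {e} → Crosses S e →
    lookup S (proj₁ (orient e)) ≡ true × ¬ lookup S (proj₂ (orient e)) ≡ true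
  orient-crossing {e} crosses with lookup S (src e) in s | lookup S (tgt e) in t
  ... | true  | true  = ⊥-elim (crosses refl)
  ... | true  | false = s , (λ ()) ∘ trans (sym t)
  ... | false | true  = t , (λ ()) ∘ trans (sym s)
  ... | false | false = ⊥-elim (crosses refl)

  crossing-count-bound : ∀ {es} → AllPairs (λ e f → ¬ SamePair e f) es →
    2 ℕ.* length (filter Crosses? es) ≤ℕ n ℕ.* n
  crossing-count-bound {es} distinct =
    subst (λ l → 2 ℕ.* l ≤ℕ n ℕ.* n) (length-map orient (filter Crosses? es))
      (length-separated-≤ (λ x → lookup S x ≡ true) unique separated)
    where
    unique : Unique (map orient (filter Crosses? es))
    unique = AllPairs.map⁺ (AllPairs.map (λ {e} {f} differ → differ ∘ orient-injective {e} {f})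
                                         (AllPairs.filter⁺ Crosses? distinct))
    separated : All (λ p → lookup S (proj₁ p) ≡ true × ¬ lookup S (proj₂ p) ≡ true)
                    (map orient (filter Crosses? es))
    separated = All.map⁺ (All.map (λ {e} → orient-crossing {e}) (all-filter Crosses? es))

  cutWeight-nonneg : ∀ es → All (λ e → 0ℚ ≤ weight e) es → 0ℚ ≤ cutWeight es S
  cutWeight-nonneg []       []         = ≤-refl
  cutWeight-nonneg (e ∷ es) (w≥0 ∷ ws) with lookup S (src e) Bool.≟ lookup S (tgt e)
  ... | yes _ = +-mono-≤ ≤-refl (cutWeight-nonneg es ws)
  ... | no  _ = +-mono-≤ w≥0 (cutWeight-nonneg es ws)

  crossing-≤-cutWeight : ∀ es → All (λ e → 0ℚ ≤ weight e) es →
    ∀ {e} → e ∈ₗ es → Crosses S e → weight e ≤ cutWeight es S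
  crossing-≤-cutWeight (e₀ ∷ es) (w₀≥0 ∷ ws) {e} e∈ crosses
    with lookup S (src e₀) Bool.≟ lookup S (tgt e₀) | e∈
  ... | yes same | here refl = ⊥-elim (crosses same)
  ... | yes _    | there e∈es = ≤-trans (≤-reflexive (sym (+-identityˡ (weight e))))
                                         (+-monoʳ-≤ 0ℚ (crossing-≤-cutWeight es ws e∈es crosses))
  ... | no  _    | here refl  = ≤-trans (≤-reflexive (sym (+-identityʳ (weight e))))
                                         (+-monoʳ-≤ (weight e) (cutWeight-nonneg es ws))
  ... | no  _    | there e∈es = ≤-trans (≤-reflexive (sym (+-identityˡ (weight e))))
                                         (+-mono-≤ w₀≥0 (crossing-≤-cutWeight es ws e∈es crosses))

  cut-shortfall : ∀ {wk} es → 1 <ℕ n → All (λ e → 0ℚ < weight e) es →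
    All (λ e → Crosses S e → weight e ≤ wk) es →
    Shortfall (ℕ→ℚ (n ^ 3)) wk (length (filter Crosses? es)) (cutWeightGk n wk es S) (cutWeight es S)
  cut-shortfall []       _   []           []              = Shortfall-0
  cut-shortfall (e ∷ es) 1<n (w>0 ∷ pos) (bounded ∷ bds)
    with lookup S (src e) Bool.≟ lookup S (tgt e)
  ... | yes _       = Shortfall-+ Shortfall-0 (cut-shortfall es 1<n pos bds)
  ... | no  crosses =
    Shortfall-+ (crossing-edge-shortfall 1<n w>0 (bounded crosses)) (cut-shortfall es 1<n pos bds)

n*lost≤W : ∀ m {lost C wk W} → ℕ→ℚ (suc m ^ 3) * lost ≤ ℕ→ℚ C * wk →
  2 ℕ.* C ≤ℕ suc m ℕ.* suc m → wk ≤ ℕ→ℚ 2 * W → 0ℚ ≤ W → ℕ→ℚ (suc m) * lost ≤ W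
n*lost≤W m {r} {C} {wk} {W} bound count wk≤2W W≥0 = *-cancelˡ-≤-pos n² {{positive n²>0}} (begin
  n² * (n * r)              ≡⟨ solve 3 (λ a b r → a :* (b :* r) := (a :* b) :* r) refl n² n r ⟩
  n² * n * r                ≡⟨ cong (_* r) (sym cube) ⟩
  ℕ→ℚ (suc m ^ 3) * r       ≤⟨ bound ⟩
  ℕ→ℚ C * wk                ≤⟨ *-monoˡ-≤-nonNeg (ℕ→ℚ C) {{nonNegative (ℕ→ℚ-mono-≤ {0} {C} z≤n)}} wk≤2W ⟩
  ℕ→ℚ C * (ℕ→ℚ 2 * W)       ≡⟨ solve 3 (λ c t w → c :* (t :* w) := (t :* c) :* w) refl (ℕ→ℚ C) (ℕ→ℚ 2) W ⟩
  ℕ→ℚ 2 * ℕ→ℚ C * W         ≡⟨ cong (_* W) (sym (ℕ→ℚ-homo-* 2 C)) ⟩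
  ℕ→ℚ (2 ℕ.* C) * W         ≤⟨ *-monoʳ-≤-nonNeg W {{nonNegative W≥0}} (ℕ→ℚ-mono-≤ count) ⟩
  n² * W                    ∎)
  where
  open ≤-Reasoning
  n n² : ℚ
  n = ℕ→ℚ (suc m)
  n² = ℕ→ℚ (suc m ℕ.* suc m)
  n²>0 : 0ℚ < n²
  n²>0 = ℕ→ℚ-mono-< {0} {suc m ℕ.* suc m} z<s
  cube : ℕ→ℚ (suc m ^ 3) ≡ n² * n
  cube = trans (cong ℕ→ℚ (trans (cong (λ x → suc m ℕ.* (suc m ℕ.* x)) (ℕ.*-identityʳ (suc m)))
                                (sym (ℕ.*-assoc (suc m) (suc m) (suc m)))))
               (ℕ→ℚ-homo-* (suc m ℕ.* suc m) (suc m))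

n*lost≤w⇒ratio : ∀ m {kept lost} → ℕ→ℚ (suc m) * lost ≤ kept + lost →
  ℕ→ℚ m * (kept + lost) ≤ ℕ→ℚ (suc m) * kept
n*lost≤w⇒ratio m {v} {r} share = begin
  M * (v + r)      ≡⟨ *-distribˡ-+ M v r ⟩
  M * v + M * r    ≤⟨ +-monoʳ-≤ (M * v) Mr≤v ⟩
  M * v + v        ≡⟨ solve 2 (λ M v → M :* v :+ v := (con 1ℚ :+ M) :* v) refl M v ⟩
  (1ℚ + M) * v     ≡⟨ cong (_* v) (sym (ℕ→ℚ-homo-+ 1 m)) ⟩
  ℕ→ℚ (suc m) * v  ∎
  where
  open ≤-Reasoning
  M : ℚ
  M = ℕ→ℚ m
  Mr≤v : M * r ≤ v
  Mr≤v = begin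
    M * r                  ≡⟨ solve 2 (λ M r → M :* r := (con 1ℚ :+ M) :* r :+ :- r) refl M r ⟩
    (1ℚ + M) * r + - r     ≡⟨ cong (λ x → x * r + - r) (sym (ℕ→ℚ-homo-+ 1 m)) ⟩
    ℕ→ℚ (suc m) * r + - r  ≤⟨ +-monoˡ-≤ (- r) share ⟩
    v + r + - r            ≡⟨ solve 2 (λ v r → v :+ r :+ :- r := v) refl v r ⟩
    v                      ∎

shortfall⇒ratio : ∀ m {wk W C g w} → Shortfall (ℕ→ℚ (suc m ^ 3)) wk C g w →
  2 ℕ.* C ≤ℕ suc m ℕ.* suc m → wk ≤ ℕ→ℚ 2 * W → 0ℚ ≤ W → W ≤ w →
  Σ ℚ λ v → g ≡ fin v × ℕ→ℚ m * w ≤ ℕ→ℚ (suc m) * v × v ≤ w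
shortfall⇒ratio m {C = C} (shortfall v r refl refl r≥0 bound) count wk≤2W W≥0 W≤w =
  v , refl , n*lost≤w⇒ratio m (≤-trans (n*lost≤W m {C = C} bound count wk≤2W W≥0) W≤w) ,
  ≤-trans (≤-reflexive (sym (+-identityʳ v))) (+-monoʳ-≤ v r≥0)

lemma4p2 : (n : ℕ) (π : List (Edge n)) →
    All (λ e → 0ℚ < weight e) π →
    All (λ e → src e ≢ tgt e) π →
    AllPairs (λ e f → ¬ SamePair e f) π →
    AllPairs (λ e f → weight f ≤ weight e) π →
    Connected n π →
    (S : Subset n) → (∃ λ x → x ∈ S) → (∃ λ y → y ∉ S) →
    (j : ℕ) (ej : Edge n) → nth (kruskal π) j ≡ just ej → Crosses S ej →
    (∀ (i : ℕ) (e : Edge n) → i <ℕ j → nth (kruskal π) i ≡ just e → ¬ Crosses S e) →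
    (k : ℕ) (ek : Edge n) → nth (kruskal π) k ≡ just ek → InJ (kruskal π) k → k ≤ℕ j →
    (∀ (k′ : ℕ) → InJ (kruskal π) k′ → k′ ≤ℕ j → k′ ≤ℕ k) →
    Σ ℚ λ v → cutWeightGk n (weight ek) π S ≡ fin v
      × (ℕ→ℚ (n ∸ 1)) * cutWeight π S ≤ ℕ→ℚ n * v
      × v ≤ cutWeight π S
lemma4p2 zero _ _ _ _ _ _ _ (() , _)
lemma4p2 (suc zero) _ _ _ _ _ _ _ (Fin.zero , x∈S) (Fin.zero , x∉S) = ⊥-elim (x∉S x∈S)
lemma4p2 (suc (suc m)) π positive _ distinct sorted _ S _ _
         j ej K[j] ej-crosses earlier k ek K[k] _ k≤j k-last =
  shortfall⇒ratio (suc m)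
    (cut-shortfall S π (s<s z<s) positive (All.tabulate λ e∈π crosses → ≤-trans (cut-edge-≤-ej e∈π crosses) ej≤ek))
    (crossing-count-bound S distinct) ek≤2ej (<⇒≤ ej>0)
    (crossing-≤-cutWeight S π (All.map <⇒≤ positive) ej∈π ej-crosses)
  where
  K⊆π : kruskal π ⊆ π
  K⊆π = kruskalGo-⊆ id π
  K-sorted : NonIncreasing (kruskal π)
  K-sorted = AllPairs-resp-⊇ K⊆π sorted
  ej∈π : ej ∈ₗ π
  ej∈π = Any-resp-⊆ K⊆π (nth-∈ (kruskal π) j K[j])
  ej>0 : 0ℚ < weight ej
  ej>0 = All.lookup positive ej∈π
  cut-edge-≤-ej : ∀ {e} → e ∈ₗ π → Crosses S e → weight e ≤ weight ej
  cut-edge-≤-ej = first-crossing-heaviest S id π (λ _ _ → cong (lookup S)) sorted j K[j] ej-crosses earlier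
  ej≤ek : weight ej ≤ weight ek
  ej≤ek = NonIncreasing-nth K-sorted k≤j K[k] K[j]
  ek≤2ej : weight ek ≤ ℕ→ℚ 2 * weight ej
  ek≤2ej with covered-by-stored (kruskal π) j K[j] (<⇒≤ ej>0)
  ... | k′ , e′ , k′≤j , k′∈J , K[k′] , e′≤2ej =
    ≤-trans (NonIncreasing-nth K-sorted (k-last k′ k′∈J k′≤j) K[k′] K[k]) e′≤2ej
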